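{- Let $k$ be an odd integer and let $A$ be a cyclically $k$-diagonal partially filled square array of size $n\geq k$ whose nonempty entries are pairwise distinct. If $\gcd(n,k-1)=1$, then there exist two compatible orderings $\omega_r$ and $\omega_c$ of the rows and the columns of $A$.
   Context: For a partially filled $n\times n$ array $A=(a_{i,j})$, the cell $(i,j)$ belongs to the diagonal $D_s$ if $j-i\equiv s-1\pmod n$. $A$ is cyclically $k$-diagonal if its nonempty cells are exactly those of the diagonals $D_s$ with $s\in\{r,\dots,r+k-1\}$ (indices mod $n$) for some $r\in\{1,\dots,n\}$. Let $N$ be the number of nonempty cells, whose entries are pairwise distinct. An ordering $\omega_r$ of the rows is a choice of a cyclic ordering of the entries of each row, regarded as a permutation of the set of the $N$ entries (the product of these disjoint cycles, one per row); similarly an ordering $\omega_c$ of the columns. $\omega_r$ and $\omega_c$ are compatible if the permutation $\omega_r\circ\omega_c$ is a single cycle of length $N$. -}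

module Defs where

open import Data.Nat using (ℕ; zero; suc; _+_; _∸_; _<ᵇ_; _%_; NonZero)
open import Data.Fin using (Fin; toℕ)
open import Data.Product using (Σ; _×_; proj₁; proj₂; ∃-syntax)
open import Data.Bool using (T)
open import Function.Bundles using (_↔_; Inverse)
open import Relation.Binary.PropositionalEquality using (_≡_)

-- Cells of an n×n array: (row i, column j), both 0-indexed.
-- Diagonal (0-indexed) of cell (i,j): (j - i) mod n, i.e. cell (i,j) ∈ D_s
-- (paper's 1-indexed s) iff diagIndex i j = s - 1.
diagIndex : (n : ℕ) → .{{NonZero n}} → Fin n → Fin n → ℕ
diagIndex n i j = (toℕ j + (n ∸ toℕ i)) % n

-- Cyclically k-diagonal pattern starting at diagonal D_r, where the paper's r
-- (1-indexed) corresponds to r₀ = r - 1 : Fin n. Cell (i,j) is nonempty iff its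
-- diagonal lies in {D_r, …, D_{r+k-1}} (mod n), i.e. (diag - r₀) mod n < k.
Filled : (n k : ℕ) → .{{NonZero n}} → Fin n → Fin n → Fin n → Set
Filled n k r₀ i j = T (((diagIndex n i j + (n ∸ toℕ r₀)) % n) <ᵇ k)

-- The nonempty cells.  Since the entries are pairwise distinct, the set of the
-- N entries is in bijection with the set of nonempty cells; we identify them.
Cell : (n k : ℕ) → .{{NonZero n}} → Fin n → Set
Cell n k r₀ = Σ (Fin n × Fin n) (λ c → Filled n k r₀ (proj₁ c) (proj₂ c))

module _ {n k : ℕ} .{{_ : NonZero n}} {r₀ : Fin n} where

  row : Cell n k r₀ → Fin n
  row c = proj₁ (proj₁ c)

  col : Cell n k r₀ → Fin n
  col c = proj₂ (proj₁ c)

iter : {A : Set} → (A → A) → ℕ → A → A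
iter f zero x = x
iter f (suc m) x = f (iter f m x)

module _ {A : Set} where

  -- ω is an ordering w.r.t. the partition given by `part`: it preserves each
  -- block and is a single cycle on each block (a cyclic ordering of each block).
  IsBlockOrdering : (part : A → A → Set) → (A ↔ A) → Set
  IsBlockOrdering part ω =
    (∀ x → part (Inverse.to ω x) x) ×
    (∀ x y → part x y → ∃[ m ] iter (Inverse.to ω) m x ≡ y)

  IsFullCycle : (A → A) → Set
  IsFullCycle σ = ∀ x y → ∃[ m ] iter σ m x ≡ y

module _ (n k : ℕ) .{{_ : NonZero n}} (r₀ : Fin n) where

  IsRowOrdering : (Cell n k r₀ ↔ Cell n k r₀) → Set
  IsRowOrdering = IsBlockOrdering (λ x y → row {n} {k} {r₀} x ≡ row {n} {k} {r₀} y)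

  IsColOrdering : (Cell n k r₀ ↔ Cell n k r₀) → Set
  IsColOrdering = IsBlockOrdering (λ x y → col {n} {k} {r₀} x ≡ col {n} {k} {r₀} y)

  Compatible : (ωr ωc : Cell n k r₀ ↔ Cell n k r₀) → Set
  Compatible ωr ωc = IsFullCycle (λ x → Inverse.to ωr (Inverse.to ωc x))

-- A nonempty cell is encoded by its row i ∈ ℤ/n and the offset d ∈ ℤ/k of its diagonal from D_r.
-- ωr runs through each row cyclically in steps of 1, except row 0 which it runs through in steps of 2
-- (a single cycle as k is odd); ωc runs down each column, the offset dropping by one each time.
-- Their product σ then moves a cell with d ≠ 0 one row down without changing d, except that d grows by
-- one when row 0 is reached; a cell with d = 0 moves n − (k − 1) rows down, and since gcd(n, k − 1) = 1
-- this eventually lands in row 0 as well. So every cell reaches (0, 0) under σ, and an injective map on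
-- a finite set with such a point is a single cycle.
module Submission where

open import Defs
open import Data.Nat using (ℕ; _≤_; _∸_; _%_; NonZero)
open import Data.Nat.GCD using (gcd)
open import Data.Fin using (Fin)
open import Data.Product using (Σ; _×_)
open import Function.Bundles using (_↔_)
open import Relation.Binary.PropositionalEquality using (_≡_)
open import Data.Nat
open import Data.Nat.Properties
open import Data.Nat.DivMod
open import Data.Nat.Divisibility using (_∣_; ∣m+n∣m⇒∣n)
open import Data.Nat.Coprimality using (Coprime; coprime-+; 1-coprimeTo; coprime-Bézout; gcd≡1⇒coprime)
  renaming (sym to coprime-sym)
open import Data.Nat.GCD using (module Bézout)
open import Data.Nat.Tactic.RingSolver using (solve-∀)
open import Data.Fin using (zero; suc; toℕ; combine; fromℕ<)
open import Data.Fin.Properties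
  using (pigeonhole; combine-injective; toℕ<n; toℕ-injective; toℕ-fromℕ<; toℕ≤pred[n])
open import Data.Bool.Properties using (T-irrelevant)
open import Data.Product
open import Function.Base using (_∘_)
open import Function.Bundles using (Inverse; Injection; mk↔ₛ′)
open import Function.Definitions using (Injective)
open import Function.Properties.Inverse using (↔⇒↣)
open import Function.Construct.Composition using (_↔-∘_)
open import Function.Construct.Symmetry using (↔-sym)
open import Relation.Binary.PropositionalEquality
open ≡-Reasoning

module _ {A : Set} (f : A → A) where

  Reach : A → A → Set
  Reach x y = ∃[ m ] iter f m x ≡ y

  iter-+ : ∀ m m′ x → iter f (m + m′) x ≡ iter f m (iter f m′ x)
  iter-+ zero    m′ x = refl
  iter-+ (suc m) m′ x = cong f (iter-+ m m′ x)

  iter-suc : ∀ m x → iter f (suc m) x ≡ iter f m (f x)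
  iter-suc m x = trans (cong (λ l → iter f l x) (+-comm 1 m)) (iter-+ m 1 x)

  iter-injective : Injective _≡_ _≡_ f → ∀ m → Injective _≡_ _≡_ (iter f m)
  iter-injective inj zero    e = e
  iter-injective inj (suc m) e = iter-injective inj m (inj e)

  iter-*-period : ∀ {p x} → iter f p x ≡ x → ∀ c → iter f (c * p) x ≡ x
  iter-*-period e zero    = refl
  iter-*-period {p} {x} e (suc c) = begin
    iter f (p + c * p) x       ≡⟨ iter-+ p (c * p) x ⟩
    iter f p (iter f (c * p) x) ≡⟨ cong (iter f p) (iter-*-period e c) ⟩
    iter f p x                 ≡⟨ e ⟩
    x                          ∎

  reach-refl : ∀ {x} → Reach x x
  reach-refl = 0 , refl

  reach-trans : ∀ {x y z} → Reach x y → Reach y z → Reach x z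
  reach-trans {x} (m , refl) (m′ , refl) = m′ + m , iter-+ m′ m x

  reach-step : ∀ {x y z} → f x ≡ y → Reach y z → Reach x z
  reach-step e = reach-trans (1 , e)

  module _ {N : ℕ} (enc : A → Fin N) (enc-injective : Injective _≡_ _≡_ enc)
           (f-injective : Injective _≡_ _≡_ f) where

    iter-returns : ∀ x → ∃[ p ] iter f (suc p) x ≡ x
    iter-returns x
      with i , j , i<j , eᵢⱼ ← pigeonhole (n<1+n N) (λ a → enc (iter f (toℕ a) x))
      with p , i+1+p≡j ← m≤n⇒∃[o]m+o≡n i<j
      = p , sym (iter-injective f-injective (toℕ i) (begin
          iter f (toℕ i) x                       ≡⟨ enc-injective eᵢⱼ ⟩
          iter f (toℕ j) x
            ≡⟨ cong (λ l → iter f l x) (trans (sym i+1+p≡j) (sym (+-suc (toℕ i) p))) ⟩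
          iter f (toℕ i + suc p) x               ≡⟨ iter-+ (toℕ i) (suc p) x ⟩
          iter f (toℕ i) (iter f (suc p) x)      ∎))

    reach-sym : ∀ {x y} → Reach x y → Reach y x
    reach-sym {x} (m , refl) with p , period ← iter-returns x = m * p , (begin
      iter f (m * p) (iter f m x) ≡⟨ sym (iter-+ (m * p) m x) ⟩
      iter f (m * p + m) x        ≡⟨ cong (λ l → iter f l x) (trans (+-comm (m * p) m) (sym (*-suc m p))) ⟩
      iter f (m * suc p) x        ≡⟨ iter-*-period period m ⟩
      x                           ∎)

iter-cong : {A : Set} {f g : A → A} → (∀ x → f x ≡ g x) → ∀ m x → iter f m x ≡ iter g m x
iter-cong f≗g zero    x = refl
iter-cong {g = g} f≗g (suc m) x = trans (f≗g _) (cong g (iter-cong f≗g m x))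

iter-invariant : {A B : Set} {f : A → A} (p : A → B) → (∀ x → p (f x) ≡ p x) →
                 ∀ m x → p (iter f m x) ≡ p x
iter-invariant p inv zero    x = refl
iter-invariant p inv (suc m) x = trans (inv _) (iter-invariant p inv m x)

iter-semiconj : {A B : Set} {f : A → A} {g : B → B} (p : A → B) → (∀ x → p (f x) ≡ g (p x)) →
                ∀ m x → p (iter f m x) ≡ iter g m (p x)
iter-semiconj p comm zero    x = refl
iter-semiconj {g = g} p comm (suc m) x = trans (comm _) (cong g (iter-semiconj p comm m x))

uncurry-combine-injective : ∀ {m n} → Injective _≡_ _≡_ (uncurry (combine {m} {n}))
uncurry-combine-injective {x = i , d} {i′ , d′} e = uncurry (cong₂ _,_) (combine-injective i d i′ d′ e)

periodic⇒↔ : {A : Set} (f : A → A) (m : ℕ) → (∀ x → iter f (suc m) x ≡ x) → A ↔ A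
periodic⇒↔ f m period = mk↔ₛ′ f (iter f m) period (λ x → trans (sym (iter-suc f m x)) (period x))

module _ {C Y : Set} (φ : C ↔ Y) where
  open Inverse φ

  conj : (Y → Y) → C → C
  conj f = from ∘ f ∘ to

  conj-↔ : Y ↔ Y → C ↔ C
  conj-↔ ω = ↔-sym φ ↔-∘ (ω ↔-∘ φ)

  iter-conj : ∀ f m x → iter (conj f) m x ≡ from (iter f m (to x))
  iter-conj f zero    x = sym (strictlyInverseʳ x)
  iter-conj f (suc m) x = cong (from ∘ f) (trans (cong to (iter-conj f m x)) (strictlyInverseˡ _))

  reach-conj : ∀ {f x y} → Reach f (to x) (to y) → Reach (conj f) x y
  reach-conj {f} {x} {y} (m , e) = m , trans (iter-conj f m x) (trans (cong from e) (strictlyInverseʳ y))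

  conj-IsBlockOrdering : {B : Set} (q : C → B) (p : Y → B) → (∀ x → q x ≡ p (to x)) →
    (ω : Y ↔ Y) → IsBlockOrdering (λ y y′ → p y ≡ p y′) ω →
    IsBlockOrdering (λ x x′ → q x ≡ q x′) (conj-↔ ω)
  conj-IsBlockOrdering q p q≡p ω (preserves , connected) =
    (λ x → trans (q≡p _) (trans (cong p (strictlyInverseˡ _)) (trans (preserves (to x)) (sym (q≡p x))))) ,
    (λ x x′ e → reach-conj (connected (to x) (to x′) (trans (sym (q≡p x)) (trans e (q≡p x′)))))

  conj-IsFullCycle : (ωr ωc : Y ↔ Y) →
    IsFullCycle (Inverse.to ωr ∘ Inverse.to ωc) →
    IsFullCycle (Inverse.to (conj-↔ ωr) ∘ Inverse.to (conj-↔ ωc))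
  conj-IsFullCycle ωr ωc full x y
    with m , e ← reach-conj {x = x} {y} (full (to x) (to y))
    = m , trans (iter-cong (λ z → cong (from ∘ Inverse.to ωr) (strictlyInverseˡ _)) m x) e

coprime-suc : ∀ m → Coprime (suc m) m
coprime-suc m = subst (λ l → Coprime l m) (+-comm m 1) (coprime-+ (1-coprimeTo m))

coprime-∸ : ∀ {m s} → s ≤ m → Coprime m s → Coprime m (m ∸ s)
coprime-∸ {m} {s} s≤m coprime (d∣m , d∣m∸s) =
  coprime (d∣m , ∣m+n∣m⇒∣n (subst (_ ∣_) (sym (m∸n+n≡m s≤m)) d∣m) d∣m∸s)

[1+q*2]-coprimeTo-2 : ∀ q → Coprime (1 + q * 2) 2
[1+q*2]-coprimeTo-2 zero    = 1-coprimeTo 2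
[1+q*2]-coprimeTo-2 (suc q) = coprime-+ ([1+q*2]-coprimeTo-2 q)

odd⇒coprimeTo-2 : ∀ {k} → k % 2 ≡ 1 → Coprime k 2
odd⇒coprimeTo-2 {k} odd = subst (λ l → Coprime l 2) (sym k≡1+q*2) ([1+q*2]-coprimeTo-2 (k / 2))
  where
  k≡1+q*2 : k ≡ 1 + k / 2 * 2
  k≡1+q*2 = trans (m≡m%n+[m/n]*n k 2) (cong (_+ k / 2 * 2) odd)

module _ {m : ℕ} where

  infixl 6 _⊕_

  -- Opaque, so that toℕ-⊕ is its only description and a, s stay inferable from a ⊕ s.
  opaque
    _⊕_ : Fin (suc m) → ℕ → Fin (suc m)
    a ⊕ s = (toℕ a + s) mod suc m

    toℕ-⊕ : ∀ a s → toℕ (a ⊕ s) ≡ (toℕ a + s) % suc m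
    toℕ-⊕ a s = toℕ-fromℕ< (m%n<n (toℕ a + s) (suc m))

  toℕ-⊕-≡ : ∀ {a s b} c₁ c₂ → toℕ a + s + c₁ * suc m ≡ b + c₂ * suc m → b < suc m →
            toℕ (a ⊕ s) ≡ b
  toℕ-⊕-≡ {a} {s} {b} c₁ c₂ e b<1+m = begin
    toℕ (a ⊕ s)                        ≡⟨ toℕ-⊕ a s ⟩
    (toℕ a + s) % suc m                ≡⟨ sym ([m+kn]%n≡m%n (toℕ a + s) c₁ (suc m)) ⟩
    (toℕ a + s + c₁ * suc m) % suc m   ≡⟨ cong (_% suc m) e ⟩
    (b + c₂ * suc m) % suc m           ≡⟨ [m+kn]%n≡m%n b c₂ (suc m) ⟩
    b % suc m                          ≡⟨ m<n⇒m%n≡m b<1+m ⟩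
    b                                  ∎

  ⊕-≡ : ∀ {a s b} c₁ c₂ → toℕ a + s + c₁ * suc m ≡ toℕ b + c₂ * suc m → a ⊕ s ≡ b
  ⊕-≡ c₁ c₂ e = toℕ-injective (toℕ-⊕-≡ c₁ c₂ e (toℕ<n _))

  toℕ+[n∸toℕ]≡n : (a : Fin (suc m)) → toℕ a + (suc m ∸ toℕ a) ≡ suc m
  toℕ+[n∸toℕ]≡n a = m+[n∸m]≡n (<⇒≤ (toℕ<n a))

  ⊕-identityʳ : ∀ a → a ⊕ 0 ≡ a
  ⊕-identityʳ a = ⊕-≡ 0 0 (cong (_+ 0) (+-identityʳ (toℕ a)))

  toℕ-⊕-divMod : ∀ a s → toℕ a + s ≡ toℕ (a ⊕ s) + (toℕ a + s) / suc m * suc m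
  toℕ-⊕-divMod a s =
    trans (m≡m%n+[m/n]*n (toℕ a + s) (suc m)) (cong (_+ (toℕ a + s) / suc m * suc m) (sym (toℕ-⊕ a s)))

  ⊕-assoc : ∀ a s t → a ⊕ s ⊕ t ≡ a ⊕ (s + t)
  ⊕-assoc a s t = ⊕-≡ q q′ (begin
    toℕ (a ⊕ s) + t + q * suc m   ≡⟨ +-assoc (toℕ (a ⊕ s)) t (q * suc m) ⟩
    toℕ (a ⊕ s) + (t + q * suc m) ≡⟨ cong (toℕ (a ⊕ s) +_) (+-comm t (q * suc m)) ⟩
    toℕ (a ⊕ s) + (q * suc m + t) ≡⟨ sym (+-assoc (toℕ (a ⊕ s)) (q * suc m) t) ⟩
    toℕ (a ⊕ s) + q * suc m + t   ≡⟨ cong (_+ t) (sym (toℕ-⊕-divMod a s)) ⟩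
    toℕ a + s + t                 ≡⟨ +-assoc (toℕ a) s t ⟩
    toℕ a + (s + t)               ≡⟨ toℕ-⊕-divMod a (s + t) ⟩
    toℕ (a ⊕ (s + t)) + q′ * suc m ∎)
    where
    q = (toℕ a + s) / suc m
    q′ = (toℕ a + (s + t)) / suc m

  ⊕-multiple : ∀ a c → a ⊕ c * suc m ≡ a
  ⊕-multiple a c = ⊕-≡ 0 c (+-identityʳ _)

  ⊕-+-multiple : ∀ a s c → a ⊕ (s + c * suc m) ≡ a ⊕ s
  ⊕-+-multiple a s c = trans (sym (⊕-assoc a s (c * suc m))) (⊕-multiple (a ⊕ s) c)

  ⊕-cancelʳ : ∀ {a b} s → a ⊕ s ≡ b ⊕ s → a ≡ b
  ⊕-cancelʳ {a} {b} s e = begin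
    a                   ≡⟨ sym (undo a) ⟩
    a ⊕ s ⊕ s * m       ≡⟨ cong (_⊕ s * m) e ⟩
    b ⊕ s ⊕ s * m       ≡⟨ undo b ⟩
    b                   ∎
    where
    undo : ∀ x → x ⊕ s ⊕ s * m ≡ x
    undo x = trans (⊕-assoc x s (s * m)) (trans (cong (x ⊕_) (sym (*-suc s m))) (⊕-multiple x s))

  iter-⊕ : ∀ s t a → iter (_⊕ s) t a ≡ a ⊕ t * s
  iter-⊕ s zero    a = sym (⊕-identityʳ a)
  iter-⊕ s (suc t) a = begin
    iter (_⊕ s) t a ⊕ s ≡⟨ cong (_⊕ s) (iter-⊕ s t a) ⟩
    a ⊕ t * s ⊕ s       ≡⟨ ⊕-assoc a (t * s) s ⟩
    a ⊕ (t * s + s)     ≡⟨ cong (a ⊕_) (+-comm (t * s) s) ⟩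
    a ⊕ suc t * s       ∎

  ⊕-pred-suc : ∀ a t → a ⊕ m ⊕ suc t ≡ a ⊕ t
  ⊕-pred-suc a t = trans (⊕-assoc a m (suc t)) (trans (cong (a ⊕_) (shuffle m t)) (⊕-+-multiple a t 1))
    where
    shuffle : ∀ m t → m + suc t ≡ t + 1 * suc m
    shuffle = solve-∀

  toℕ-zero⊕m : toℕ (zero ⊕ m) ≡ m
  toℕ-zero⊕m = toℕ-⊕-≡ 0 0 refl ≤-refl

  toℕ-suc⊕m : (a : Fin m) → toℕ (suc a ⊕ m) ≡ toℕ a
  toℕ-suc⊕m a = toℕ-⊕-≡ 0 1 (shuffle (toℕ a) m) (<-trans (toℕ<n a) (n<1+n m))
    where
    shuffle : ∀ a m → suc a + m + 0 * suc m ≡ a + 1 * suc m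
    shuffle = solve-∀

  toℕ-⊕1 : ∀ {a} → toℕ a < m → toℕ (a ⊕ 1) ≡ suc (toℕ a)
  toℕ-⊕1 {a} a<m = toℕ-⊕-≡ 0 0 (cong (_+ 0) (+-comm (toℕ a) 1)) (s≤s a<m)

  ⊕1≡zero : ∀ {a} → toℕ a ≡ m → a ⊕ 1 ≡ zero
  ⊕1≡zero a≡m = ⊕-≡ 0 1 (trans (cong (λ l → l + 1 + 0) a≡m) (shuffle m))
    where
    shuffle : ∀ m → m + 1 + 0 ≡ 0 + 1 * suc m
    shuffle = solve-∀

  coprime⇒unit : ∀ {s} → Coprime (suc m) s →
                 ∃[ u ] ∃[ c₁ ] ∃[ c₂ ] u * s + c₁ * suc m ≡ 1 + c₂ * suc m
  coprime⇒unit {s} coprime with coprime-Bézout coprime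
  ... | Bézout.-+ x y 1+xM≡ys = y , 0 , x , trans (+-identityʳ (y * s)) (sym 1+xM≡ys)
  ... | Bézout.+- x y 1+ys≡xM = y * m , 1 , x * m , (begin
    y * m * s + 1 * suc m   ≡⟨ expand y m s ⟩
    1 + m * (1 + y * s)     ≡⟨ cong (λ l → 1 + m * l) 1+ys≡xM ⟩
    1 + m * (x * suc m)     ≡⟨ cong (1 +_) (sym (*-assoc m x (suc m))) ⟩
    1 + m * x * suc m       ≡⟨ cong (λ l → 1 + l * suc m) (*-comm m x) ⟩
    1 + x * m * suc m       ∎)
    where
    expand : ∀ y m s → y * m * s + 1 * suc m ≡ 1 + m * (1 + y * s)
    expand = solve-∀

  coprime⇒⊕-orbit : ∀ {s} → Coprime (suc m) s → ∀ a b → Reach (_⊕ s) a b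
  -- D ≡ b − a, and D·u steps of size s add D·u·s ≡ D.
  coprime⇒⊕-orbit {s} coprime a b with u , c₁ , c₂ , us≡1 ← coprime⇒unit coprime =
    D * u , trans (iter-⊕ s (D * u) a) (⊕-≡ (D * c₁) (1 + D * c₂) (begin
      toℕ a + D * u * s + D * c₁ * suc m   ≡⟨ factor (toℕ a) D u s c₁ (suc m) ⟩
      toℕ a + D * (u * s + c₁ * suc m)     ≡⟨ cong (λ l → toℕ a + D * l) us≡1 ⟩
      toℕ a + D * (1 + c₂ * suc m)         ≡⟨ expand (toℕ a) D c₂ (suc m) ⟩
      toℕ a + D + D * c₂ * suc m           ≡⟨ cong (_+ D * c₂ * suc m) a+D≡b+M ⟩
      toℕ b + suc m + D * c₂ * suc m       ≡⟨ collect (toℕ b) (suc m) D c₂ ⟩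
      toℕ b + (1 + D * c₂) * suc m         ∎))
    where
    D = toℕ b + (suc m ∸ toℕ a)
    a+D≡b+M : toℕ a + D ≡ toℕ b + suc m
    a+D≡b+M = begin
      toℕ a + (toℕ b + (suc m ∸ toℕ a)) ≡⟨ sym (+-assoc (toℕ a) (toℕ b) _) ⟩
      toℕ a + toℕ b + (suc m ∸ toℕ a)   ≡⟨ cong (_+ (suc m ∸ toℕ a)) (+-comm (toℕ a) (toℕ b)) ⟩
      toℕ b + toℕ a + (suc m ∸ toℕ a)   ≡⟨ +-assoc (toℕ b) (toℕ a) _ ⟩
      toℕ b + (toℕ a + (suc m ∸ toℕ a)) ≡⟨ cong (toℕ b +_) (toℕ+[n∸toℕ]≡n a) ⟩
      toℕ b + suc m                     ∎
    factor : ∀ a D u s c M → a + D * u * s + D * c * M ≡ a + D * (u * s + c * M)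
    factor = solve-∀
    expand : ∀ a D c M → a + D * (1 + c * M) ≡ a + D + D * c * M
    expand = solve-∀
    collect : ∀ b M D c → b + M + D * c * M ≡ b + (1 + D * c) * M
    collect = solve-∀

χ₀ : ∀ {m} → Fin m → ℕ
χ₀ zero    = 1
χ₀ (suc _) = 0

module Diagonals (n′ k′ : ℕ) (r : Fin (suc n′)) (k≤n : suc k′ ≤ suc n′)
                 (k⊥2 : Coprime (suc k′) 2) (n⊥k′ : Coprime (suc n′) k′) where

  n k : ℕ
  n = suc n′
  k = suc k′

  k′≤n : k′ ≤ n
  k′≤n = ≤-trans (n≤1+n k′) k≤n

  Pos : Set
  Pos = Fin n × Fin k

  column : Pos → Fin n
  column (i , d) = i ⊕ (toℕ d + toℕ r)

  ωr : Pos → Pos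
  ωr (i , d) = (i , d ⊕ suc (χ₀ i))

  -- Going down a column the offset drops by one, wrapping from 0 to k − 1.
  rowShift : Fin k → ℕ
  rowShift zero    = n ∸ k′
  rowShift (suc _) = 1

  ωc : Pos → Pos
  ωc (i , d) = (i ⊕ rowShift d , d ⊕ k′)

  σ : Pos → Pos
  σ z = ωr (ωc z)

  iter-ωr : ∀ t i d → iter ωr t (i , d) ≡ (i , iter (_⊕ suc (χ₀ i)) t d)
  iter-ωr zero    i d = refl
  iter-ωr (suc t) i d = cong ωr (iter-ωr t i d)

  ωr-period : ∀ z → iter ωr k z ≡ z
  ωr-period (i , d) = trans (iter-ωr k i d) (cong (i ,_) (begin
    iter (_⊕ s) k d ≡⟨ iter-⊕ s k d ⟩
    d ⊕ k * s       ≡⟨ cong (d ⊕_) (*-comm k s) ⟩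
    d ⊕ s * k       ≡⟨ ⊕-multiple d s ⟩
    d               ∎))
    where s = suc (χ₀ i)

  coprime-rowStep : (i : Fin n) → Coprime k (suc (χ₀ i))
  coprime-rowStep zero    = k⊥2
  coprime-rowStep (suc _) = coprime-sym (1-coprimeTo k)

  ωr↔ : Pos ↔ Pos
  ωr↔ = periodic⇒↔ ωr k′ ωr-period

  ωr-rows : IsBlockOrdering (λ z z′ → proj₁ z ≡ proj₁ z′) ωr↔
  ωr-rows = (λ _ → refl) , connected
    where
    connected : ∀ z z′ → proj₁ z ≡ proj₁ z′ → Reach ωr z z′
    connected (i , d) (.i , d′) refl =
      let t , e = coprime⇒⊕-orbit (coprime-rowStep i) d d′
      in  t , trans (iter-ωr t i d) (cong (i ,_) e)

  ωc-column : ∀ z → column (ωc z) ≡ column z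
  ωc-column (i , zero) = begin
    i ⊕ (n ∸ k′) ⊕ (toℕ (zero ⊕ k′) + toℕ r) ≡⟨ cong (λ l → i ⊕ (n ∸ k′) ⊕ (l + toℕ r)) toℕ-zero⊕m ⟩
    i ⊕ (n ∸ k′) ⊕ (k′ + toℕ r)              ≡⟨ ⊕-assoc i (n ∸ k′) (k′ + toℕ r) ⟩
    i ⊕ (n ∸ k′ + (k′ + toℕ r))              ≡⟨ cong (i ⊕_) n∸k′+[k′+r]≡r+n ⟩
    i ⊕ (toℕ r + 1 * n)                      ≡⟨ ⊕-+-multiple i (toℕ r) 1 ⟩
    i ⊕ toℕ r                                ∎
    where
    n∸k′+[k′+r]≡r+n : n ∸ k′ + (k′ + toℕ r) ≡ toℕ r + 1 * n
    n∸k′+[k′+r]≡r+n = begin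
      n ∸ k′ + (k′ + toℕ r) ≡⟨ sym (+-assoc (n ∸ k′) k′ (toℕ r)) ⟩
      n ∸ k′ + k′ + toℕ r   ≡⟨ cong (_+ toℕ r) (m∸n+n≡m k′≤n) ⟩
      n + toℕ r             ≡⟨ +-comm n (toℕ r) ⟩
      toℕ r + n             ≡⟨ cong (toℕ r +_) (sym (*-identityˡ n)) ⟩
      toℕ r + 1 * n         ∎
  ωc-column (i , suc d) = begin
    i ⊕ 1 ⊕ (toℕ (suc d ⊕ k′) + toℕ r)
      ≡⟨ cong (λ l → i ⊕ 1 ⊕ (l + toℕ r)) (toℕ-suc⊕m d) ⟩
    i ⊕ 1 ⊕ (toℕ d + toℕ r)            ≡⟨ ⊕-assoc i 1 (toℕ d + toℕ r) ⟩
    i ⊕ suc (toℕ d + toℕ r)            ∎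

  Pos-≡ : ∀ {z z′} → column z ≡ column z′ → proj₂ z ≡ proj₂ z′ → z ≡ z′
  Pos-≡ {i , d} {i′ , .d} e refl = cong (_, d) (⊕-cancelʳ (toℕ d + toℕ r) e)

  iter-ωc-column : ∀ t z → column (iter ωc t z) ≡ column z
  iter-ωc-column = iter-invariant column ωc-column

  iter-ωc-offset : ∀ t z → proj₂ (iter ωc t z) ≡ iter (_⊕ k′) t (proj₂ z)
  iter-ωc-offset = iter-semiconj proj₂ (λ _ → refl)

  ωc-period : ∀ z → iter ωc k z ≡ z
  ωc-period z@(i , d) = Pos-≡ (iter-ωc-column k z) (begin
    proj₂ (iter ωc k z) ≡⟨ iter-ωc-offset k z ⟩
    iter (_⊕ k′) k d    ≡⟨ iter-⊕ k′ k d ⟩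
    d ⊕ k * k′          ≡⟨ cong (d ⊕_) (*-comm k k′) ⟩
    d ⊕ k′ * k          ≡⟨ ⊕-multiple d k′ ⟩
    d                   ∎)

  ωc↔ : Pos ↔ Pos
  ωc↔ = periodic⇒↔ ωc k′ ωc-period

  ωc-columns : IsBlockOrdering (λ z z′ → column z ≡ column z′) ωc↔
  ωc-columns = ωc-column , connected
    where
    connected : ∀ z z′ → column z ≡ column z′ → Reach ωc z z′
    connected z z′ e =
      let t , e′ = coprime⇒⊕-orbit (coprime-suc k′) (proj₂ z) (proj₂ z′)
      in  t , Pos-≡ (trans (iter-ωc-column t z) e) (trans (iter-ωc-offset t z) e′)

  σ-≡ : ∀ i d → σ (i , d) ≡ (i ⊕ rowShift d , d ⊕ χ₀ (i ⊕ rowShift d))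
  σ-≡ i d = cong (i ⊕ rowShift d ,_) (⊕-pred-suc d (χ₀ (i ⊕ rowShift d)))

  P₀ : Pos
  P₀ = (zero , zero)

  reach-row₀ : ∀ t i d → toℕ i + t ≡ n′ → Reach σ (i , suc d) (zero , suc d ⊕ 1)
  reach-row₀ zero i d i+0≡n′ =
    1 , trans (σ-≡ i (suc d))
              (cong (λ j → (j , suc d ⊕ χ₀ j)) (⊕1≡zero (trans (sym (+-identityʳ (toℕ i))) i+0≡n′)))
  reach-row₀ (suc t) i d i+1+t≡n′ = reach-step σ (σ-≡ i (suc d)) (continue (i ⊕ 1) (toℕ-⊕1 i<n′))
    where
    i<n′ : toℕ i < n′
    i<n′ = subst (toℕ i <_) i+1+t≡n′ (m<m+n (toℕ i) z<s)
    continue : ∀ j → toℕ j ≡ suc (toℕ i) → Reach σ (j , suc d ⊕ χ₀ j) (zero , suc d ⊕ 1)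
    continue zero    ()
    continue (suc j) j≡i =
      subst (λ x → Reach σ (suc j , x) (zero , suc d ⊕ 1)) (sym (⊕-identityʳ (suc d)))
        (reach-row₀ t (suc j) d (trans (cong (_+ t) j≡i) (trans (sym (+-suc (toℕ i) t)) i+1+t≡n′)))

  row₀-reach-P₀′ : ∀ u d → toℕ d + u ≡ k′ → Reach σ (zero , d) P₀
  row₀-reach-P₀′ u zero _ = reach-refl σ
  row₀-reach-P₀′ zero (suc d) d+0≡k′ = reach-trans σ (reach-row₀ n′ zero d refl)
    (0 , cong (zero ,_) (⊕1≡zero (trans (sym (+-identityʳ _)) d+0≡k′)))
  row₀-reach-P₀′ (suc u) (suc d) d+1+u≡k′ = reach-trans σ (reach-row₀ n′ zero d refl)
    (row₀-reach-P₀′ u (suc d ⊕ 1)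
      (trans (cong (_+ u) (toℕ-⊕1 d<k′)) (trans (sym (+-suc _ u)) d+1+u≡k′)))
    where
    d<k′ : suc (toℕ d) < k′
    d<k′ = subst (suc (toℕ d) <_) d+1+u≡k′ (m<m+n (suc (toℕ d)) z<s)

  row₀-reach-P₀ : ∀ d → Reach σ (zero , d) P₀
  row₀-reach-P₀ d = row₀-reach-P₀′ (k′ ∸ toℕ d) d (m+[n∸m]≡n (toℕ≤pred[n] d))

  offset₀-reach-P₀ : ∀ t i → iter (_⊕ (n ∸ k′)) t i ≡ zero → Reach σ (i , zero) P₀
  offset₀-reach-P₀ zero    .zero refl = reach-refl σ
  offset₀-reach-P₀ (suc t) i e =
    reach-step σ (σ-≡ i zero) (continue (i ⊕ (n ∸ k′)) (trans (sym (iter-suc _ t i)) e))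
    where
    continue : ∀ j → iter (_⊕ (n ∸ k′)) t j ≡ zero → Reach σ (j , zero ⊕ χ₀ j) P₀
    continue zero    _  = row₀-reach-P₀ _
    continue (suc j) e′ =
      subst (λ x → Reach σ (suc j , x) P₀) (sym (⊕-identityʳ zero)) (offset₀-reach-P₀ t (suc j) e′)

  reach-P₀ : ∀ z → Reach σ z P₀
  reach-P₀ (i , zero) =
    let t , e = coprime⇒⊕-orbit (coprime-∸ k′≤n n⊥k′) i zero in offset₀-reach-P₀ t i e
  reach-P₀ (i , suc d) =
    reach-trans σ (reach-row₀ (n′ ∸ toℕ i) i d (m+[n∸m]≡n (toℕ≤pred[n] i))) (row₀-reach-P₀ _)

  σ-fullCycle : IsFullCycle σ
  σ-fullCycle x y = reach-trans σ (reach-P₀ x)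
    (reach-sym σ (uncurry combine) uncurry-combine-injective σ-injective (reach-P₀ y))
    where
    σ-injective : Injective _≡_ _≡_ σ
    σ-injective = Injection.injective (↔⇒↣ (ωr↔ ↔-∘ ωc↔))

  -- Filled n k r i j unfolds to T (offset i j <ᵇ k).
  offset : Fin n → Fin n → ℕ
  offset i j = (diagIndex n i j + (n ∸ toℕ r)) % n

  offset-⊕ : ∀ i j → offset i j ≡ toℕ (j ⊕ (n ∸ toℕ i + (n ∸ toℕ r)))
  offset-⊕ i j = begin
    ((toℕ j + (n ∸ toℕ i)) % n + (n ∸ toℕ r)) % n
      ≡⟨ cong (λ l → (l + (n ∸ toℕ r)) % n) (sym (toℕ-⊕ j _)) ⟩
    (toℕ (j ⊕ (n ∸ toℕ i)) + (n ∸ toℕ r)) % n     ≡⟨ sym (toℕ-⊕ (j ⊕ (n ∸ toℕ i)) _) ⟩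
    toℕ (j ⊕ (n ∸ toℕ i) ⊕ (n ∸ toℕ r))           ≡⟨ cong toℕ (⊕-assoc j _ _) ⟩
    toℕ (j ⊕ (n ∸ toℕ i + (n ∸ toℕ r)))           ∎

  two-turns : ∀ i x → x + (toℕ i + (n ∸ toℕ i)) + (toℕ r + (n ∸ toℕ r)) ≡ x + 2 * n
  two-turns i x = begin
    x + (toℕ i + (n ∸ toℕ i)) + (toℕ r + (n ∸ toℕ r))
      ≡⟨ cong₂ (λ a b → x + a + b) (toℕ+[n∸toℕ]≡n i) (toℕ+[n∸toℕ]≡n r) ⟩
    x + n + n                                         ≡⟨ double x n ⟩
    x + 2 * n                                         ∎
    where
    double : ∀ x n → x + n + n ≡ x + 2 * n
    double = solve-∀

  offset-column : ∀ i d → offset i (column (i , d)) ≡ toℕ d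
  offset-column i d = begin
    offset i (i ⊕ (toℕ d + toℕ r))                             ≡⟨ offset-⊕ i _ ⟩
    toℕ (i ⊕ (toℕ d + toℕ r) ⊕ (n ∸ toℕ i + (n ∸ toℕ r)))      ≡⟨ cong toℕ (⊕-assoc i _ _) ⟩
    toℕ (i ⊕ (toℕ d + toℕ r + (n ∸ toℕ i + (n ∸ toℕ r))))
      ≡⟨ toℕ-⊕-≡ 0 2 (trans (shuffle (toℕ i) (toℕ d) (toℕ r) _ _) (two-turns i (toℕ d)))
                     (<-≤-trans (toℕ<n d) k≤n) ⟩
    toℕ d                                                      ∎
    where
    shuffle : ∀ i d r u w → i + (d + r + (u + w)) + 0 * suc n′ ≡ d + (i + u) + (r + w)
    shuffle = solve-∀

  column-offset : ∀ i j (p : offset i j < k) → column (i , fromℕ< p) ≡ j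
  column-offset i j p = begin
    i ⊕ (toℕ (fromℕ< p) + toℕ r)
      ≡⟨ cong (λ l → i ⊕ (l + toℕ r)) (trans (toℕ-fromℕ< p) (offset-⊕ i j)) ⟩
    i ⊕ (toℕ (j ⊕ u) + toℕ r)    ≡⟨ ⊕-≡ q 2 (begin
      toℕ i + (toℕ (j ⊕ u) + toℕ r) + q * n  ≡⟨ shuffle₁ (toℕ i) (toℕ (j ⊕ u)) (toℕ r) (q * n) ⟩
      toℕ i + toℕ r + (toℕ (j ⊕ u) + q * n)  ≡⟨ cong (toℕ i + toℕ r +_) (sym (toℕ-⊕-divMod j u)) ⟩
      toℕ i + toℕ r + (toℕ j + u)
        ≡⟨ shuffle₂ (toℕ i) (toℕ r) (toℕ j) (n ∸ toℕ i) (n ∸ toℕ r) ⟩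
      toℕ j + (toℕ i + (n ∸ toℕ i)) + (toℕ r + (n ∸ toℕ r)) ≡⟨ two-turns i (toℕ j) ⟩
      toℕ j + 2 * n                          ∎) ⟩
    j                            ∎
    where
    u = n ∸ toℕ i + (n ∸ toℕ r)
    q = (toℕ j + u) / n
    shuffle₁ : ∀ i o r c → i + (o + r) + c ≡ i + r + (o + c)
    shuffle₁ = solve-∀
    shuffle₂ : ∀ i r j u w → i + r + (j + (u + w)) ≡ j + (i + u) + (r + w)
    shuffle₂ = solve-∀

  toPos : Cell n k r → Pos
  toPos ((i , j) , filled) = (i , fromℕ< (<ᵇ⇒< (offset i j) k filled))

  fromPos : Pos → Cell n k r
  fromPos z@(i , d) = (i , column z) , <⇒<ᵇ (subst (_< k) (sym (offset-column i d)) (toℕ<n d))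

  cell-≡ : ∀ {c c′ : Cell n k r} → proj₁ c ≡ proj₁ c′ → c ≡ c′
  cell-≡ {x , p} {.x , p′} refl = cong (x ,_) (T-irrelevant p p′)

  column-toPos : ∀ c → col {n} {k} {r} c ≡ column (toPos c)
  column-toPos ((i , j) , filled) = sym (column-offset i j (<ᵇ⇒< (offset i j) k filled))

  cells : Cell n k r ↔ Pos
  cells = mk↔ₛ′ toPos fromPos
    (λ (i , d) → cong (i ,_) (toℕ-injective (trans (toℕ-fromℕ< _) (offset-column i d))))
    (λ c → cell-≡ (cong (row {n} {k} {r} c ,_) (sym (column-toPos c))))

  orderings : Σ (Cell n k r ↔ Cell n k r) λ ωr → Σ (Cell n k r ↔ Cell n k r) λ ωc →
              IsRowOrdering n k r ωr × IsColOrdering n k r ωc × Compatible n k r ωr ωc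
  orderings =
    conj-↔ cells ωr↔ , conj-↔ cells ωc↔ ,
    conj-IsBlockOrdering cells (row {n} {k} {r}) proj₁ (λ _ → refl) ωr↔ ωr-rows ,
    conj-IsBlockOrdering cells (col {n} {k} {r}) column column-toPos ωc↔ ωc-columns ,
    conj-IsFullCycle cells ωr↔ ωc↔ σ-fullCycle

proposition3p4 : (n k : ℕ) .{{_ : NonZero n}} (r₀ : Fin n) →
    k % 2 ≡ 1 → k ≤ n → gcd n (k ∸ 1) ≡ 1 →
    Σ (Cell n k r₀ ↔ Cell n k r₀) λ ωr → Σ (Cell n k r₀ ↔ Cell n k r₀) λ ωc →
      IsRowOrdering n k r₀ ωr × IsColOrdering n k r₀ ωc × Compatible n k r₀ ωr ωc
proposition3p4 n        zero     r₀ ()  _   _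
proposition3p4 zero     (suc k′) r₀ _   ()  _
proposition3p4 (suc n′) (suc k′) r₀ odd k≤n gcd≡1 =
  Diagonals.orderings n′ k′ r₀ k≤n (odd⇒coprimeTo-2 odd) (gcd≡1⇒coprime gcd≡1)
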